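{- Let $G$ be a simple graph with $n \geq 3$ vertices and $m$ edges, with largest degree $\Delta$ and smallest degree $\delta > 0$, and degree sequence $\Delta = d_1 \geq \cdots \geq d_n = \delta$. Then \[ {}^{m}M_1(G) \geq \frac{ID(G)^2}{n} + \frac{1}{2}\left(\frac{1}{\Delta} - \frac{1}{\delta}\right)^2 + \frac{2n}{n-2}\left(\frac{ID(G)}{n} - \frac{1}{2}\left(\frac{1}{\Delta} + \frac{1}{\delta}\right)\right)^2. \] Equality holds if and only if $G$ is regular or $G \in \Gamma_{2,n}$ or $G \in \Gamma_{1,n-1}$ or $G \in \Gamma_{2,n-1}$.
   Context: ${}^{m}M_1(G) = \sum_{i=1}^n \frac{1}{d_i^2}$, $ID(G) = \sum_{i=1}^n \frac{1}{d_i}$. For $1 \le i < j \le n$, $\Gamma_{i,j}$ denotes the class of graphs (with vertices ordered so that $d_1 \ge \cdots \ge d_n$) such that $d_i = d_{i+1} = \cdots = d_j$. -}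

module Defs where

open import Data.Bool using (Bool; true; false)
open import Data.Nat using (ℕ; zero; suc; _≤_; _∸_)
open import Data.Fin using (Fin; toℕ)
open import Data.List using (List; length; filterᵇ; map; foldr)
open import Data.List using () renaming (allFin to allFinL)
open import Data.Integer using (+_)
open import Data.Rational using (ℚ; 0ℚ; _+_; _/_)
open import Relation.Binary.PropositionalEquality using (_≡_)

record SimpleGraph (n : ℕ) : Set where
  field
    adj     : Fin n → Fin n → Bool
    symm    : ∀ u v → adj u v ≡ adj v u
    irrefl  : ∀ v → adj v v ≡ false

open SimpleGraph public

deg : ∀ {n} → SimpleGraph n → Fin n → ℕ
deg {n} G v = length (filterᵇ (adj G v) (allFinL n))

-- 1/d as a rational (the value at d = 0 is irrelevant: all degrees are positive below)
inv : ℕ → ℚ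
inv zero    = 0ℚ
inv (suc k) = (+ 1) / suc k

sumℚ : List ℚ → ℚ
sumℚ = foldr _+_ 0ℚ

mM1 : ∀ {n} → SimpleGraph n → ℚ
mM1 {n} G = sumℚ (map (λ v → inv (deg G v) Data.Rational.* inv (deg G v)) (allFinL n))

ID : ∀ {n} → SimpleGraph n → ℚ
ID {n} G = sumℚ (map (λ v → inv (deg G v)) (allFinL n))

-- vertices are ordered so that d_1 ≥ d_2 ≥ ... ≥ d_n
-- (vertex k : Fin n is the (toℕ k + 1)-th vertex)
DegreeSorted : ∀ {n} → SimpleGraph n → Set
DegreeSorted G = ∀ u v → toℕ u ≤ toℕ v → deg G v ≤ deg G u

Regular : ∀ {n} → SimpleGraph n → Set
Regular G = ∀ u v → deg G u ≡ deg G v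

-- Γ_{i,j} (1-based indices): d_i = d_{i+1} = ... = d_j
Γ : ∀ {n} → ℕ → ℕ → SimpleGraph n → Set
Γ i j G = ∀ u v → i ≤ suc (toℕ u) → suc (toℕ u) ≤ j
                → i ≤ suc (toℕ v) → suc (toℕ v) ≤ j → deg G u ≡ deg G v

ℕ→ℚ : ℕ → ℚ
ℕ→ℚ k = (+ k) / 1

-- Put a = 1/Δ, b = 1/δ, let y be the reciprocals of the n - 2 interior degrees d_2, …, d_{n-1},
-- S = Σ y and Var = Σ (y_i - S/(n-2))². Since the degrees are sorted, a and b are the first and
-- last terms of ID(G), so mM1(G) = a² + b² + S²/(n-2) + Var, while the right-hand side at
-- ID(G) = a + S + b simplifies to a² + b² + S²/(n-2). Hence mM1(G) - rhs = Var ≥ 0, with equality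
-- iff the interior degrees coincide, i.e. iff G ∈ Γ_{2,n-1}, a class containing the other three
-- equality cases.
module Submission where

open import Defs
open import Data.Nat using (ℕ; _<_; _∸_; suc) renaming (_≤_ to _≤ₙ_; _*_ to _*ₙ_)
open import Data.Fin using (Fin)
open import Data.Integer using (+_)
open import Data.Product using (Σ; _×_)
open import Data.Sum using (_⊎_)
open import Data.Rational using (ℚ; _+_; _-_; _*_; _/_; ½) renaming (_≤_ to _≤ℚ_)
open import Function.Bundles using (_⇔_)
open import Relation.Binary.PropositionalEquality using (_≡_)

open import Level using (0ℓ)
open import Data.Nat using (zero; z≤n; s≤s) renaming (_+_ to _+ₙ_)
import Data.Nat.Properties as ℕ
open import Data.Nat.Coprimality using (1-coprimeTo) renaming (sym to coprime-sym)
open import Data.Fin using (toℕ; fromℕ; inject₁; lower₁)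
import Data.Fin as Fin
import Data.Fin.Properties as Fin
import Data.Integer as ℤ
import Data.Integer.Properties as ℤ
open import Data.Product using (_,_)
open import Data.Sum using (inj₁; inj₂; [_,_])
open import Data.List using (map; tabulate) renaming (allFin to allFinL)
open import Data.List.Properties using (map-tabulate)
open import Data.Vec.Functional using (Vector; head; tail; init; last)
open import Data.Rational
  using (0ℚ; 1ℚ; mkℚ; ↧ₙ_; 1/_; ≢-nonZero; nonNegative; nonPositive)
import Data.Rational.Properties as ℚ
open import Algebra.Properties.Monoid.Sum ℚ.+-0-monoid
  using (sum; sum-init-last; sum-cong-≗; sum-replicate-zero)
open import Algebra.Properties.Group ℚ.+-0-group using (identityʳ-unique; x∙y⁻¹≈ε⇒x≈y)
open import Tactic.RingSolver using (solve-∀)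
open import Tactic.RingSolver.Core.AlmostCommutativeRing
  using (AlmostCommutativeRing; fromCommutativeRing)
open import Function using (_∘_; id)
open import Function.Bundles using (mk⇔)
open import Function.Properties.Equivalence using (⇔-setoid)
import Relation.Binary.Reasoning.Setoid as SetoidReasoning
open import Relation.Binary.PropositionalEquality
  using (refl; sym; trans; cong; cong₂; subst; subst₂; module ≡-Reasoning)
open import Relation.Nullary using (yes; no)
open import Relation.Nullary.Decidable using (dec⇒maybe)

ℚ-ring : AlmostCommutativeRing 0ℓ 0ℓ
ℚ-ring = fromCommutativeRing ℚ.+-*-commutativeRing (λ x → dec⇒maybe (0ℚ ℚ.≟ x))

sq : ℚ → ℚ
sq x = x * x

interior : ∀ {n} {A : Set} → Vector A (suc (suc n)) → Vector A n
interior = init ∘ tail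

ℕ→ℚ≡mkℚ : ∀ k → ℕ→ℚ k ≡ mkℚ (+ k) 0 (coprime-sym (1-coprimeTo k))
ℕ→ℚ≡mkℚ k = ℚ.normalize-coprime (coprime-sym (1-coprimeTo k))

inv≡mkℚ : ∀ k → inv (suc k) ≡ mkℚ (+ 1) k (1-coprimeTo (suc k))
inv≡mkℚ k = ℚ.normalize-coprime (1-coprimeTo (suc k))

ℕ→ℚ-+ : ∀ m n → ℕ→ℚ (m +ₙ n) ≡ ℕ→ℚ m + ℕ→ℚ n
ℕ→ℚ-+ m n rewrite ℕ→ℚ≡mkℚ m | ℕ→ℚ≡mkℚ n =
  cong (_/ 1) (trans (ℤ.pos-+ m n) (sym (cong₂ ℤ._+_ (ℤ.*-identityʳ (+ m)) (ℤ.*-identityʳ (+ n)))))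

ℕ→ℚ-* : ∀ m n → ℕ→ℚ (m *ₙ n) ≡ ℕ→ℚ m * ℕ→ℚ n
ℕ→ℚ-* m n rewrite ℕ→ℚ≡mkℚ m | ℕ→ℚ≡mkℚ n = cong (_/ 1) (ℤ.pos-* m n)

ℕ→ℚ*inv≡1 : ∀ k → ℕ→ℚ (suc k) * inv (suc k) ≡ 1ℚ
ℕ→ℚ*inv≡1 k rewrite ℕ→ℚ≡mkℚ (suc k) | inv≡mkℚ k =
  ℚ.*-inverseʳ (mkℚ (+ suc k) 0 (coprime-sym (1-coprimeTo (suc k))))

inv-injective : ∀ {a b} → 0 < a → 0 < b → inv a ≡ inv b → a ≡ b
inv-injective {suc a} {suc b} _ _ eq rewrite inv≡mkℚ a | inv≡mkℚ b = cong ↧ₙ_ eq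

sq-nonneg : ∀ x → 0ℚ ≤ℚ sq x
sq-nonneg x with ℚ.≤-total 0ℚ x
... | inj₁ 0≤x = ℚ.nonNegative⁻¹ (sq x) {{ℚ.nonNeg*nonNeg⇒nonNeg x x}}
  where instance _ = nonNegative 0≤x
... | inj₂ x≤0 = ℚ.nonNegative⁻¹ (sq x) {{ℚ.nonPos*nonPos⇒nonPos x x}}
  where instance _ = nonPositive x≤0

sq≡0⇒≡0 : ∀ x → sq x ≡ 0ℚ → x ≡ 0ℚ
sq≡0⇒≡0 x x²≡0 with x ℚ.≟ 0ℚ
... | yes x≡0 = x≡0
... | no x≢0 = begin
  x                ≡⟨ ℚ.*-identityʳ x ⟨
  x * 1ℚ           ≡⟨ cong (x *_) (ℚ.*-inverseʳ x) ⟨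
  x * (x * 1/ x)   ≡⟨ ℚ.*-assoc x x (1/ x) ⟨
  sq x * 1/ x      ≡⟨ cong (_* 1/ x) x²≡0 ⟩
  0ℚ * 1/ x        ≡⟨ ℚ.*-zeroˡ (1/ x) ⟩
  0ℚ               ∎
  where
  open ≡-Reasoning
  instance _ = ≢-nonZero x≢0

nonneg+nonneg≡0⇒≡0 : ∀ {p q} → 0ℚ ≤ℚ p → 0ℚ ≤ℚ q → p + q ≡ 0ℚ → p ≡ 0ℚ × q ≡ 0ℚ
nonneg+nonneg≡0⇒≡0 {p} {q} p≥0 q≥0 p+q≡0 =
  p≡0 , trans (sym (ℚ.+-identityˡ q)) (trans (cong (_+ q) (sym p≡0)) p+q≡0)
  where
  p≡0 : p ≡ 0ℚ
  p≡0 = ℚ.≤-antisym (subst₂ _≤ℚ_ (ℚ.+-identityʳ p) p+q≡0 (ℚ.+-monoʳ-≤ p q≥0)) p≥0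

x≡r+v⇒[x≡r⇔v≡0] : ∀ {x r v} → x ≡ r + v → (x ≡ r ⇔ v ≡ 0ℚ)
x≡r+v⇒[x≡r⇔v≡0] {r = r} {v} x≡r+v = mk⇔
  (λ x≡r → identityʳ-unique r v (trans (sym x≡r+v) x≡r))
  (λ v≡0 → trans x≡r+v (trans (cong (_+_ r) v≡0) (ℚ.+-identityʳ r)))

p+[x-y]*q≡p : ∀ p q {x y} → x ≡ y → p + (x - y) * q ≡ p
p+[x-y]*q≡p p q {x} refl = lemma p q x
  where
  lemma : ∀ p q x → p + (x - x) * q ≡ p
  lemma = solve-∀ ℚ-ring

sumℚ-tabulate : ∀ {n} (f : Vector ℚ n) → sumℚ (tabulate f) ≡ sum f
sumℚ-tabulate {zero}  f = refl
sumℚ-tabulate {suc n} f = cong (_+_ (head f)) (sumℚ-tabulate (tail f))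

sumℚ-map-allFin : ∀ {n} (f : Vector ℚ n) → sumℚ (map f (allFinL n)) ≡ sum f
sumℚ-map-allFin f = trans (cong sumℚ (map-tabulate id f)) (sumℚ-tabulate f)

sum-head-interior-last : ∀ {n} (f : Vector ℚ (suc (suc n))) →
                         sum f ≡ head f + (sum (interior f) + last f)
sum-head-interior-last f = cong (_+_ (head f)) (sum-init-last (tail f))

sum-replicate : ∀ {n} c → sum {n} (λ _ → c) ≡ ℕ→ℚ n * c
sum-replicate {zero}  c = sym (ℚ.*-zeroˡ c)
sum-replicate {suc n} c = begin
  c + sum {n} (λ _ → c)   ≡⟨ cong (_+_ c) (sum-replicate {n} c) ⟩
  c + ℕ→ℚ n * c           ≡⟨ cong (_+ ℕ→ℚ n * c) (ℚ.*-identityˡ c) ⟨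
  1ℚ * c + ℕ→ℚ n * c      ≡⟨ ℚ.*-distribʳ-+ c 1ℚ (ℕ→ℚ n) ⟨
  (1ℚ + ℕ→ℚ n) * c        ≡⟨ cong (_* c) (ℕ→ℚ-+ 1 n) ⟨
  ℕ→ℚ (suc n) * c         ∎
  where open ≡-Reasoning

sum-nonneg : ∀ {n} (f : Vector ℚ n) → (∀ i → 0ℚ ≤ℚ f i) → 0ℚ ≤ℚ sum f
sum-nonneg {zero}  f f≥0 = ℚ.≤-refl
sum-nonneg {suc n} f f≥0 = ℚ.+-mono-≤ (f≥0 Fin.zero) (sum-nonneg (tail f) (f≥0 ∘ Fin.suc))

sum-nonneg≡0⇒≡0 : ∀ {n} (f : Vector ℚ n) → (∀ i → 0ℚ ≤ℚ f i) → sum f ≡ 0ℚ → ∀ i → f i ≡ 0ℚ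
sum-nonneg≡0⇒≡0 {suc n} f f≥0 Σf≡0 i
  with nonneg+nonneg≡0⇒≡0 (f≥0 Fin.zero) (sum-nonneg (tail f) (f≥0 ∘ Fin.suc)) Σf≡0
sum-nonneg≡0⇒≡0 f f≥0 Σf≡0 Fin.zero    | f₀≡0 , _ = f₀≡0
sum-nonneg≡0⇒≡0 f f≥0 Σf≡0 (Fin.suc i) | _ , Σtail≡0 =
  sum-nonneg≡0⇒≡0 (tail f) (f≥0 ∘ Fin.suc) Σtail≡0 i

sum-sq-deviation : ∀ {n} (y : Vector ℚ n) m →
                   sum (λ i → sq (y i - m)) ≡ sum (sq ∘ y) - (m + m) * sum y + ℕ→ℚ n * sq m
sum-sq-deviation {zero}  y m = zero-case m
  where
  zero-case : ∀ m → 0ℚ ≡ 0ℚ - (m + m) * 0ℚ + 0ℚ * (m * m)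
  zero-case = solve-∀ ℚ-ring
sum-sq-deviation {suc n} y m = begin
  sq (y₀ - m) + sum (λ i → sq (tail y i - m))
    ≡⟨ cong (_+_ (sq (y₀ - m))) (sum-sq-deviation (tail y) m) ⟩
  sq (y₀ - m) + (Q - (m + m) * S + N * sq m)
    ≡⟨ expand y₀ m Q S N ⟩
  (sq y₀ + Q) - (m + m) * (y₀ + S) + (1ℚ + N) * sq m
    ≡⟨ cong (λ N′ → (sq y₀ + Q) - (m + m) * (y₀ + S) + N′ * sq m) (ℕ→ℚ-+ 1 n) ⟨
  (sq y₀ + Q) - (m + m) * (y₀ + S) + ℕ→ℚ (suc n) * sq m
    ∎
  where
  open ≡-Reasoning
  y₀ = head y
  Q = sum (sq ∘ tail y)
  S = sum (tail y)
  N = ℕ→ℚ n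
  expand : ∀ y₀ m Q S N → (y₀ - m) * (y₀ - m) + (Q - (m + m) * S + N * (m * m))
                        ≡ (y₀ * y₀ + Q) - (m + m) * (y₀ + S) + (1ℚ + N) * (m * m)
  expand = solve-∀ ℚ-ring

module Deviation {k} (y : Vector ℚ (suc k)) where

  mean : ℚ
  mean = sum y * inv (suc k)

  deviation : ℚ
  deviation = sum (λ i → sq (y i - mean))

  sum-sq≡sq-sum*inv+deviation : sum (sq ∘ y) ≡ sq (sum y) * inv (suc k) + deviation
  sum-sq≡sq-sum*inv+deviation = sym (begin
    S * S * w + deviation
      ≡⟨ cong (_+_ (S * S * w)) (sum-sq-deviation y mean) ⟩
    S * S * w + (Q - (S * w + S * w) * S + K * sq (S * w))
      ≡⟨ regroup S Q K w ⟩
    Q + (K * w - 1ℚ) * (S * S * w)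
      ≡⟨ p+[x-y]*q≡p Q (S * S * w) (ℕ→ℚ*inv≡1 k) ⟩
    Q ∎)
    where
    open ≡-Reasoning
    S = sum y
    Q = sum (sq ∘ y)
    K = ℕ→ℚ (suc k)
    w = inv (suc k)
    regroup : ∀ S Q K w → S * S * w + (Q - (S * w + S * w) * S + K * ((S * w) * (S * w)))
                        ≡ Q + (K * w - 1ℚ) * (S * S * w)
    regroup = solve-∀ ℚ-ring

  deviation-nonneg : 0ℚ ≤ℚ deviation
  deviation-nonneg = sum-nonneg _ (λ i → sq-nonneg (y i - mean))

  deviation≡0⇔constant : deviation ≡ 0ℚ ⇔ (∀ i j → y i ≡ y j)
  deviation≡0⇔constant = mk⇔ constant deviation≡0
    where
    ≡mean : deviation ≡ 0ℚ → ∀ i → y i ≡ mean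
    ≡mean dev≡0 i = x∙y⁻¹≈ε⇒x≈y (y i) mean
      (sq≡0⇒≡0 _ (sum-nonneg≡0⇒≡0 _ (λ j → sq-nonneg (y j - mean)) dev≡0 i))

    constant : deviation ≡ 0ℚ → ∀ i j → y i ≡ y j
    constant dev≡0 i j = trans (≡mean dev≡0 i) (sym (≡mean dev≡0 j))

    deviation≡0 : (∀ i j → y i ≡ y j) → deviation ≡ 0ℚ
    deviation≡0 y-const = begin
      sum (λ i → sq (y i - mean))
        ≡⟨ sum-cong-≗ (λ i → cong (λ x → sq (x - mean)) (y-const i Fin.zero)) ⟩
      sum {suc k} (λ _ → sq (c - mean))  ≡⟨ cong (λ m → sum {suc k} (λ _ → sq (c - m))) mean≡c ⟩
      sum {suc k} (λ _ → sq (c - c))     ≡⟨ cong (λ z → sum {suc k} (λ _ → sq z)) (ℚ.+-inverseʳ c) ⟩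
      sum {suc k} (λ _ → 0ℚ)             ≡⟨ sum-replicate-zero (suc k) ⟩
      0ℚ                                 ∎
      where
      open ≡-Reasoning
      c = y Fin.zero
      mean≡c : mean ≡ c
      mean≡c = begin
        sum y * w
          ≡⟨ cong (_* w) (trans (sum-cong-≗ (λ i → y-const i Fin.zero)) (sum-replicate {suc k} c)) ⟩
        K * c * w             ≡⟨ regroup K c w ⟩
        c + (K * w - 1ℚ) * c  ≡⟨ p+[x-y]*q≡p c c (ℕ→ℚ*inv≡1 k) ⟩
        c                     ∎
        where
        K = ℕ→ℚ (suc k)
        w = inv (suc k)
        regroup : ∀ K c w → K * c * w ≡ c + (K * w - 1ℚ) * c
        regroup = solve-∀ ℚ-ring

lowerBound : ℕ → ℚ → ℚ → ℚ → ℚ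
lowerBound n a b I = (I * I) * inv n
                     + ½ * ((a - b) * (a - b))
                     + (ℕ→ℚ (2 *ₙ n) * inv (n ∸ 2))
                       * ((I * inv n - ½ * (a + b)) * (I * inv n - ½ * (a + b)))

-- Polynomial identity in which c, u, w stand for 2n, 1/n, 1/(n-2) with n = K + 2; the last
-- three summands vanish once c = 2n, n u = 1 and K w = 1.
lowerBound-certificate : ∀ a b S c K u w →
  let I = a + (S + b); n = K + ℕ→ℚ 2 in
  (I * I) * u + ½ * ((a - b) * (a - b)) + (c * w) * ((I * u - ½ * (a + b)) * (I * u - ½ * (a + b)))
  ≡ a * a + b * b + S * S * w
    + (c - ℕ→ℚ 2 * n) * (w * ((I * u - ½ * (a + b)) * (I * u - ½ * (a + b))))
    + (n * u - 1ℚ) * (w * I * (I + ℕ→ℚ 2 * u * I - ℕ→ℚ 2 * (a + b)))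
    + (K * w - 1ℚ) * (½ * (a + b) * (a + b) - u * I * I)
lowerBound-certificate = solve-∀ ℚ-ring

lowerBound-split : ∀ k a b S →
  lowerBound (3 +ₙ k) a b (a + (S + b)) ≡ a * a + b * b + S * S * inv (suc k)
lowerBound-split k a b S =
  trans (lowerBound-certificate a b S (ℕ→ℚ (2 *ₙ n)) K (inv n) (inv (suc k)))
    (trans (p+[x-y]*q≡p _ _ (ℕ→ℚ*inv≡1 k))
      (trans (p+[x-y]*q≡p _ _ [K+2]*inv-n≡1) (p+[x-y]*q≡p _ _ 2n≡2[K+2])))
  where
  n = 3 +ₙ k
  K = ℕ→ℚ (suc k)
  n≡K+2 : ℕ→ℚ n ≡ K + ℕ→ℚ 2
  n≡K+2 = trans (cong ℕ→ℚ (ℕ.+-comm 2 (suc k))) (ℕ→ℚ-+ (suc k) 2)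
  2n≡2[K+2] : ℕ→ℚ (2 *ₙ n) ≡ ℕ→ℚ 2 * (K + ℕ→ℚ 2)
  2n≡2[K+2] = trans (ℕ→ℚ-* 2 n) (cong (ℕ→ℚ 2 *_) n≡K+2)
  [K+2]*inv-n≡1 : (K + ℕ→ℚ 2) * inv n ≡ 1ℚ
  [K+2]*inv-n≡1 = trans (cong (_* inv n) (sym n≡K+2)) (ℕ→ℚ*inv≡1 (suc (suc k)))

module _ {n} (G : SimpleGraph (suc n)) (sorted : DegreeSorted G) where

  sorted⇒deg-head≡max : ∀ {Δ} → (∀ v → deg G v ≤ₙ Δ) → Σ (Fin (suc n)) (λ v → deg G v ≡ Δ) →
                        deg G Fin.zero ≡ Δ
  sorted⇒deg-head≡max ≤Δ (v , dv≡Δ) =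
    ℕ.≤-antisym (≤Δ Fin.zero) (subst (_≤ₙ deg G Fin.zero) dv≡Δ (sorted Fin.zero v z≤n))

  sorted⇒deg-last≡min : ∀ {δ} → (∀ v → δ ≤ₙ deg G v) → Σ (Fin (suc n)) (λ v → deg G v ≡ δ) →
                        deg G (fromℕ n) ≡ δ
  sorted⇒deg-last≡min δ≤ (v , dv≡δ) =
    ℕ.≤-antisym (subst (deg G (fromℕ n) ≤ₙ_) dv≡δ (sorted v (fromℕ n) v≤n)) (δ≤ (fromℕ n))
    where
    v≤n : toℕ v ≤ₙ toℕ (fromℕ n)
    v≤n = subst (toℕ v ≤ₙ_) (sym (Fin.toℕ-fromℕ n)) (ℕ.≤-pred (Fin.toℕ<n v))

Γ-mono : ∀ {n i j i′ j′} {G : SimpleGraph n} → i ≤ₙ i′ → j′ ≤ₙ j → Γ i j G → Γ i′ j′ G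
Γ-mono i≤i′ j′≤j Γij u v i′≤u u≤j′ i′≤v v≤j′ =
  Γij u v (ℕ.≤-trans i≤i′ i′≤u) (ℕ.≤-trans u≤j′ j′≤j) (ℕ.≤-trans i≤i′ i′≤v) (ℕ.≤-trans v≤j′ j′≤j)

Regular⇒Γ : ∀ {n i j} {G : SimpleGraph n} → Regular G → Γ i j G
Regular⇒Γ regular u v _ _ _ _ = regular u v

equality-cases⇔Γ₂,ₙ₋₁ : ∀ {n} (G : SimpleGraph n) →
  (Regular G ⊎ Γ 2 n G ⊎ Γ 1 (n ∸ 1) G ⊎ Γ 2 (n ∸ 1) G) ⇔ Γ 2 (n ∸ 1) G
equality-cases⇔Γ₂,ₙ₋₁ {n} G = mk⇔
  [ Regular⇒Γ {G = G}
  , [ Γ-mono {G = G} ℕ.≤-refl (ℕ.m∸n≤m n 1)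
    , [ Γ-mono {G = G} (s≤s z≤n) ℕ.≤-refl , id ] ] ]
  (inj₂ ∘ inj₂ ∘ inj₂)

Γ₂,ₙ₋₁⇔interior-constant : ∀ {k} (G : SimpleGraph (suc (suc k))) →
  Γ 2 (suc k) G ⇔ (∀ i j → interior (deg G) i ≡ interior (deg G) j)
Γ₂,ₙ₋₁⇔interior-constant {k} G = mk⇔
  (λ Γ₂ i j → Γ₂ _ _ (s≤s (s≤s z≤n)) (s≤s (Fin.inject₁ℕ< i))
                    (s≤s (s≤s z≤n)) (s≤s (Fin.inject₁ℕ< j)))
  from
  where
  interior-index : ∀ (u : Fin (suc (suc k))) → 2 ≤ₙ suc (toℕ u) → suc (toℕ u) ≤ₙ suc k →
                   Σ (Fin k) (λ i → Fin.suc (inject₁ i) ≡ u)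
  interior-index Fin.zero    (s≤s ()) _
  interior-index (Fin.suc u) _ (s≤s u<k) =
    lower₁ u (ℕ.>⇒≢ u<k) , cong Fin.suc (Fin.inject₁-lower₁ u (ℕ.>⇒≢ u<k))

  from : (∀ i j → interior (deg G) i ≡ interior (deg G) j) → Γ 2 (suc k) G
  from constant u v 2≤u u≤k 2≤v v≤k
    with interior-index u 2≤u u≤k | interior-index v 2≤v v≤k
  ... | i , refl | j , refl = constant i j

inv-constant⇔constant : ∀ {k} (d : Vector ℕ k) → (∀ i → 0 < d i) →
                        (∀ i j → inv (d i) ≡ inv (d j)) ⇔ (∀ i j → d i ≡ d j)
inv-constant⇔constant d d>0 =
  mk⇔ (λ inv-const i j → inv-injective (d>0 i) (d>0 j) (inv-const i j))
      (λ const i j → cong inv (const i j))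

sumℚ-map-deg : ∀ {k Δ δ} (G : SimpleGraph (suc (suc k))) →
  deg G Fin.zero ≡ Δ → deg G (fromℕ (suc k)) ≡ δ → ∀ (g : ℕ → ℚ) →
  sumℚ (map (g ∘ deg G) (allFinL _)) ≡ g Δ + (sum (interior (g ∘ deg G)) + g δ)
sumℚ-map-deg G d₀≡Δ dₗ≡δ g =
  trans (sumℚ-map-allFin (g ∘ deg G)) (trans (sum-head-interior-last (g ∘ deg G))
    (cong₂ (λ d₀ dₗ → g d₀ + (sum (interior (g ∘ deg G)) + g dₗ)) d₀≡Δ dₗ≡δ))

mM1≡lowerBound+deviation : ∀ {k Δ δ} (G : SimpleGraph (3 +ₙ k)) →
  deg G Fin.zero ≡ Δ → deg G (fromℕ (2 +ₙ k)) ≡ δ →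
  mM1 G ≡ lowerBound (3 +ₙ k) (inv Δ) (inv δ) (ID G) + Deviation.deviation (interior (inv ∘ deg G))
mM1≡lowerBound+deviation {k} {Δ} {δ} G d₀≡Δ dₗ≡δ = begin
  mM1 G
    ≡⟨ sumℚ-map-deg G d₀≡Δ dₗ≡δ (sq ∘ inv) ⟩
  sq a + (sum (sq ∘ y) + sq b)
    ≡⟨ cong (λ Q → sq a + (Q + sq b)) sum-sq≡sq-sum*inv+deviation ⟩
  sq a + (sq S * w + deviation + sq b)
    ≡⟨ regroup a b S w deviation ⟩
  a * a + b * b + S * S * w + deviation
    ≡⟨ cong (_+ deviation) (lowerBound-split k a b S) ⟨
  lowerBound (3 +ₙ k) a b (a + (S + b)) + deviation
    ≡⟨ cong (λ I → lowerBound (3 +ₙ k) a b I + deviation) (sumℚ-map-deg G d₀≡Δ dₗ≡δ inv) ⟨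
  lowerBound (3 +ₙ k) a b (ID G) + deviation
    ∎
  where
  open ≡-Reasoning
  y = interior (inv ∘ deg G)
  open Deviation y
  a = inv Δ
  b = inv δ
  S = sum y
  w = inv (suc k)
  regroup : ∀ a b S w v → a * a + ((S * S) * w + v + b * b) ≡ a * a + b * b + S * S * w + v
  regroup = solve-∀ ℚ-ring

corollary10 : (n : ℕ) → 3 ≤ₙ n → (G : SimpleGraph n) → DegreeSorted G →
    (Δ δ : ℕ) →
    (∀ v → deg G v ≤ₙ Δ) → Σ (Fin n) (λ v → deg G v ≡ Δ) →
    (∀ v → δ ≤ₙ deg G v) → Σ (Fin n) (λ v → deg G v ≡ δ) →
    0 < δ →
    let rhs = (ID G * ID G) * inv n
              + ½ * ((inv Δ - inv δ) * (inv Δ - inv δ))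
              + (ℕ→ℚ (2 *ₙ n) * inv (n ∸ 2))
                * ((ID G * inv n - ½ * (inv Δ + inv δ))
                   * (ID G * inv n - ½ * (inv Δ + inv δ)))
    in (rhs ≤ℚ mM1 G)
       × ((mM1 G ≡ rhs) ⇔ (Regular G ⊎ Γ 2 n G ⊎ Γ 1 (n ∸ 1) G ⊎ Γ 2 (n ∸ 1) G))
corollary10 (suc (suc (suc k))) (s≤s (s≤s (s≤s z≤n))) G sorted Δ δ ≤Δ maxAt δ≤ minAt δ>0 =
  rhs≤mM1 , equality
  where
  open Deviation (interior (inv ∘ deg G))
  rhs = lowerBound (3 +ₙ k) (inv Δ) (inv δ) (ID G)

  mM1≡rhs+deviation : mM1 G ≡ rhs + deviation
  mM1≡rhs+deviation = mM1≡lowerBound+deviation G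
    (sorted⇒deg-head≡max G sorted ≤Δ maxAt) (sorted⇒deg-last≡min G sorted δ≤ minAt)

  rhs≤mM1 : rhs ≤ℚ mM1 G
  rhs≤mM1 = subst₂ _≤ℚ_ (ℚ.+-identityʳ rhs) (sym mM1≡rhs+deviation)
                        (ℚ.+-monoʳ-≤ rhs deviation-nonneg)

  equality : (mM1 G ≡ rhs) ⇔ (Regular G ⊎ Γ 2 (3 +ₙ k) G ⊎ Γ 1 (2 +ₙ k) G ⊎ Γ 2 (2 +ₙ k) G)
  equality = begin
    mM1 G ≡ rhs                                             ≈⟨ x≡r+v⇒[x≡r⇔v≡0] mM1≡rhs+deviation ⟩
    deviation ≡ 0ℚ                                          ≈⟨ deviation≡0⇔constant ⟩
    (∀ i j → interior (inv ∘ deg G) i ≡ interior (inv ∘ deg G) j)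
      ≈⟨ inv-constant⇔constant (interior (deg G)) (λ i → ℕ.<-≤-trans δ>0 (δ≤ _)) ⟩
    (∀ i j → interior (deg G) i ≡ interior (deg G) j)      ≈⟨ Γ₂,ₙ₋₁⇔interior-constant G ⟨
    Γ 2 (2 +ₙ k) G                                          ≈⟨ equality-cases⇔Γ₂,ₙ₋₁ G ⟨
    (Regular G ⊎ Γ 2 (3 +ₙ k) G ⊎ Γ 1 (2 +ₙ k) G ⊎ Γ 2 (2 +ₙ k) G) ∎
    where open SetoidReasoning (⇔-setoid 0ℓ)
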